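{- Let $A$ be a finite non-empty alphabet, let $\lambda$ be a left-infinite word over $A$ and $\rho$ a right-infinite word over $A$. The set $ROG_{\lambda,\rho}=\{rog(\lambda_n,\rho_n): n\in\mathbb{N}\}$ is finite if and only if $\lambda={}^{\omega}u\,w_1$ and $\rho=w_2\,u^{\omega}$ for some words $u\in A^+$ and $w_1,w_2\in A^*$.
   Context: $A^*$ is the free monoid (finite words, including the empty word) and $A^+$ the set of non-empty finite words over $A$; $\mathbb{N}=\{0,1,2,\dots\}$. A left-infinite word is a sequence $\cdots a_{ -2}a_{ -1}a_0$ of letters indexed by $-\mathbb{N}$; a right-infinite word is a sequence $a_0a_1a_2\cdots$ indexed by $\mathbb{N}$. For $u\in A^+$ and $w\in A^*$, ${}^{\omega}u\,w$ denotes the left-infinite word $\cdots uuuw$ and $w\,u^{\omega}$ the right-infinite word $wuuu\cdots$. For $n\in\mathbb{N}$, $\lambda_n$ is the suffix of length $n$ of $\lambda$ and $\rho_n$ the prefix of length $n$ of $\rho$. For finite words $u,v$ of equal length, $rog(u,v)=\min\{n\in\mathbb{N}: xu=vx' \text{ for some } x,x'\in A^n\}$. -}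

module Defs where

open import Data.Nat using (ℕ; zero; suc; _≤_; _<ᵇ_; _∸_; _%_)
open import Data.Bool using (if_then_else_)
open import Data.List using (List; []; _∷_; _++_; length; reverse; map)
open import Data.List.NonEmpty using (List⁺; _∷_; toList)
open import Data.List.Membership.Propositional using (_∈_)
open import Data.Product using (Σ; _×_; ∃; ∃-syntax)
open import Relation.Binary.PropositionalEquality using (_≡_)

-- A left-infinite word ⋯ a₋₂ a₋₁ a₀ is represented as λ : ℕ → A with λ i = a₋ᵢ.
-- A right-infinite word a₀ a₁ a₂ ⋯ is represented as ρ : ℕ → A with ρ i = aᵢ.

range : ℕ → List ℕ
range zero = []
range (suc n) = range n ++ (n ∷ [])

suffixL : {A : Set} → (ℕ → A) → ℕ → List A
suffixL l n = reverse (map l (range n))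

prefixR : {A : Set} → (ℕ → A) → ℕ → List A
prefixR r n = map r (range n)

RogWitness : {A : Set} → List A → List A → ℕ → Set
RogWitness {A} u v n =
  Σ (List A) λ x → Σ (List A) λ x' →
    (length x ≡ n) × (length x' ≡ n) × (x ++ u ≡ v ++ x')

IsRog : {A : Set} → List A → List A → ℕ → Set
IsRog u v m = RogWitness u v m × (∀ n → RogWitness u v n → m ≤ n)

InROG : {A : Set} → (ℕ → A) → (ℕ → A) → ℕ → Set
InROG l r m = ∃[ n ] IsRog (suffixL l n) (prefixR r n) m

FiniteSet : (ℕ → Set) → Set
FiniteSet P = ∃[ L ] (∀ m → P m → m ∈ L)

-- i-th letter of a list (with a default value, only used in range)
at : {A : Set} → A → List A → ℕ → A
at d [] i = d
at d (a ∷ as) zero = a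
at d (a ∷ as) (suc i) = at d as i

-- ᵚu w : the left-infinite word ⋯ u u u w
leftWord : {A : Set} → List⁺ A → List A → ℕ → A
leftWord (a ∷ as) w i =
  if i <ᵇ length w
  then at a (reverse w) i
  else at a (reverse (a ∷ as)) ((i ∸ length w) % suc (length as))

-- w uᵚ : the right-infinite word w u u u ⋯
rightWord : {A : Set} → List A → List⁺ A → ℕ → A
rightWord w (a ∷ as) i =
  if i <ᵇ length w
  then at a w i
  else at a (a ∷ as) ((i ∸ length w) % suc (length as))

-- Write λ k for the letter of λ at depth k. A word x of length m ≤ n with x λₙ = ρₙ x′ exists
-- exactly when λ k = ρ s for all k, s ≥ m with k + s + 1 = n + m: λ and ρ match along an
-- antidiagonal. If all rogs are at most M, every window [n, n + M] therefore contains an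
-- antidiagonal on which λ and ρ match beyond M. Two of them at distance d ≤ 2M + 1 make both words
-- locally d-periodic beyond M, hence (2M + 1)!-periodic, and a third one glues the period of λ to
-- the reversed period of ρ. Conversely, for λ = ᵚu w₁ and ρ = w₂ uᵚ we have
-- λ (|w₁| + x) = ρ (|w₂| + y) whenever |u| divides x + y + 1, so for every n there is a matching
-- antidiagonal with m ≤ |w₁| + |w₂| + |u|.

module Submission where

open import Defs
open import Data.Nat using (ℕ; suc)
open import Data.Fin using (Fin)
open import Data.List using (List)
open import Data.List.NonEmpty using (List⁺)
open import Data.Product using (Σ; _×_)
open import Function.Bundles using (_↔_; _⇔_)
open import Relation.Binary.PropositionalEquality using (_≡_)

open import Data.Bool using (true; false; if_then_else_)
open import Data.Empty using (⊥-elim)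
import Data.Fin as Fin
open import Data.List using ([]; _∷_; _++_; length; reverse; upTo)
open import Data.List.Extrema.Nat using (max; xs≤max)
open import Data.List.Membership.Propositional.Properties using (∈-upTo⁺)
open import Data.List.NonEmpty using (_∷_)
open import Data.List.Properties
  using (≡-dec; length-++; length-map; length-reverse; map-++; reverse-involutive; unfold-reverse)
import Data.List.Relation.Unary.All as All
open import Data.Nat
open import Data.Nat.DivMod
open import Data.Nat.Divisibility
  using (_∣_; divides; ∣-trans; ∣m+n∣m⇒∣n; m∣m*n; n∣m*n; m≤n⇒m!∣n!)
open import Data.Nat.Properties
open import Data.Nat.Tactic.RingSolver using (solve; solve-∀)
open import Data.Product using (_,_; proj₁; proj₂; ∃-syntax; ∃₂)
open import Data.Sum using (_⊎_; inj₁; inj₂; [_,_]′)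
open import Function.Base using (_∋_)
open import Function.Bundles using (mk⇔)
open import Function.Properties.Inverse using (↔⇒↣)
open import Relation.Binary using (DecidableEquality)
open import Relation.Binary.PropositionalEquality
open import Relation.Nullary using (¬_; yes; no)
open import Relation.Nullary.Decidable using (via-injection)
open import Relation.Unary using (Decidable)
open ≡-Reasoning

private variable
  A : Set

p∣n∧0<n<p+p⇒n≡p : {p n : ℕ} → p ∣ n → 0 < n → n < p + p → n ≡ p
p∣n∧0<n<p+p⇒n≡p         (divides zero          refl) ()
p∣n∧0<n<p+p⇒n≡p {p}     (divides (suc zero)    refl) _ _    = +-identityʳ p
p∣n∧0<n<p+p⇒n≡p {p}     (divides (suc (suc q)) refl) _ n<2p =
  ⊥-elim (<⇒≱ n<2p (+-monoʳ-≤ p (m≤m+n p (q * p))))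

%-complement : (p : ℕ) .{{_ : NonZero p}} {x y : ℕ} → p ∣ x + suc y →
               x % p + suc (y % p) ≡ p
%-complement p {x} {y} p∣x+1+y = p∣n∧0<n<p+p⇒n≡p p∣rest
  (≤-trans (s≤s z≤n) (m≤n+m (suc (y % p)) (x % p)))
  (+-mono-<-≤ (m%n<n x p) (m%n<n y p))
  where
  regroup : ∀ a b c e p → (a + b * p) + suc (c + e * p) ≡ (b + e) * p + (a + suc c)
  regroup = solve-∀
  split : x + suc y ≡ (x / p + y / p) * p + (x % p + suc (y % p))
  split = begin
    x + suc y
      ≡⟨ cong₂ (λ a b → a + suc b) (m≡m%n+[m/n]*n x p) (m≡m%n+[m/n]*n y p) ⟩
    (x % p + x / p * p) + suc (y % p + y / p * p)
      ≡⟨ regroup (x % p) (x / p) (y % p) (y / p) p ⟩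
    (x / p + y / p) * p + (x % p + suc (y % p))
      ∎
  p∣rest : p ∣ x % p + suc (y % p)
  p∣rest = ∣m+n∣m⇒∣n (subst (p ∣_) split p∣x+1+y) (n∣m*n (x / p + y / p))

next-multiple : (n p : ℕ) .{{_ : NonZero p}} → ∃[ e ] e ≤ p × p ∣ n + e
next-multiple n p = p ∸ n % p , m∸n≤m p (n % p) , divides (suc (n / p)) (begin
  n + (p ∸ n % p)                   ≡⟨ cong (_+ (p ∸ n % p)) (m≡m%n+[m/n]*n n p) ⟩
  n % p + n / p * p + (p ∸ n % p)   ≡⟨ cong (_+ (p ∸ n % p)) (+-comm (n % p) (n / p * p)) ⟩
  n / p * p + n % p + (p ∸ n % p)   ≡⟨ +-assoc (n / p * p) (n % p) (p ∸ n % p) ⟩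
  n / p * p + (n % p + (p ∸ n % p)) ≡⟨ cong (n / p * p +_) (m+[n∸m]≡n (<⇒≤ (m%n<n n p))) ⟩
  n / p * p + p                     ≡⟨ +-comm (n / p * p) p ⟩
  suc (n / p) * p                   ∎)

0<m≤n⇒m∣n! : {m n : ℕ} → 0 < m → m ≤ n → m ∣ n !
0<m≤n⇒m∣n! {suc k} _ m≤n = ∣-trans (m∣m*n (k !)) (m≤n⇒m!∣n! m≤n)

least-below : {P : ℕ → Set} → Decidable P → ∀ n →
              (∃[ m ] m < n × P m × (∀ {k} → k < m → ¬ P k)) ⊎ (∀ {k} → k < n → ¬ P k)
least-below P? zero = inj₂ λ ()
least-below P? (suc n) with least-below P? n
... | inj₁ (m , m<n , Pm , below-m) = inj₁ (m , m<n⇒m<1+n m<n , Pm , below-m)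
... | inj₂ none-below with P? n
...   | yes Pn  = inj₁ (n , n<1+n n , Pn , none-below)
...   | no  ¬Pn =
  inj₂ λ k<1+n → [ none-below , (λ { refl → ¬Pn }) ]′ (m<1+n⇒m<n∨m≡n k<1+n)

least : {P : ℕ → Set} → Decidable P → ∀ {n} → P n →
        ∃[ m ] m ≤ n × P m × (∀ {k} → k < m → ¬ P k)
least P? {n} Pn with least-below P? (suc n)
... | inj₁ (m , m<1+n , Pm , below-m) = m , ≤-pred m<1+n , Pm , below-m
... | inj₂ none-below                  = ⊥-elim (none-below (n<1+n n) Pn)

if-<ᵇ-yes : {B : Set} {i n : ℕ} {x y : B} → i < n → (if i <ᵇ n then x else y) ≡ x
if-<ᵇ-yes {i = i} {n} i<n with i <ᵇ n | <⇒<ᵇ i<n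
... | true  | _  = refl
... | false | ()

if-<ᵇ-no : {B : Set} {i n : ℕ} {x y : B} → n ≤ i → (if i <ᵇ n then x else y) ≡ y
if-<ᵇ-no {i = i} {n} n≤i with i <ᵇ n | <ᵇ⇒< i n
... | true  | i<n = ⊥-elim (<⇒≱ (i<n _) n≤i)
... | false | _   = refl

at-++ˡ : (d : A) (xs ys : List A) {i : ℕ} → i < length xs → at d (xs ++ ys) i ≡ at d xs i
at-++ˡ d (x ∷ xs) ys {zero}  _         = refl
at-++ˡ d (x ∷ xs) ys {suc i} (s≤s i<n) = at-++ˡ d xs ys i<n

at-++ʳ : (d : A) (xs ys : List A) {i j : ℕ} → length xs + j ≡ i → at d (xs ++ ys) i ≡ at d ys j
at-++ʳ d []       ys refl = refl
at-++ʳ d (x ∷ xs) ys refl = at-++ʳ d xs ys refl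

at-reverse : (d : A) (xs : List A) {i q : ℕ} → i + suc q ≡ length xs →
             at d (reverse xs) i ≡ at d xs q
at-reverse d [] {i} eq = ⊥-elim (m+1+n≢0 i eq)
at-reverse d (x ∷ xs) {i} {zero} eq = begin
  at d (reverse (x ∷ xs)) i     ≡⟨ cong (λ ys → at d ys i) (unfold-reverse x xs) ⟩
  at d (reverse xs ++ x ∷ []) i ≡⟨ at-++ʳ d (reverse xs) (x ∷ []) |rev-xs|≡i ⟩
  x                             ∎
  where
  |rev-xs|≡i : length (reverse xs) + 0 ≡ i
  |rev-xs|≡i = trans (+-identityʳ _)
                     (trans (length-reverse xs) (sym (suc-injective (trans (+-comm 1 i) eq))))
at-reverse d (x ∷ xs) {i} {suc q} eq = begin
  at d (reverse (x ∷ xs)) i     ≡⟨ cong (λ ys → at d ys i) (unfold-reverse x xs) ⟩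
  at d (reverse xs ++ x ∷ []) i ≡⟨ at-++ˡ d (reverse xs) (x ∷ []) i<|rev-xs| ⟩
  at d (reverse xs) i           ≡⟨ at-reverse d xs i+1+q≡|xs| ⟩
  at d xs q                     ∎
  where
  i+1+q≡|xs| : i + suc q ≡ length xs
  i+1+q≡|xs| = suc-injective (trans (sym (+-suc i (suc q))) eq)
  i<|rev-xs| : i < length (reverse xs)
  i<|rev-xs| = <-≤-trans (m<m+n i z<s)
                         (≤-reflexive (trans i+1+q≡|xs| (sym (length-reverse xs))))

at-ext : (d : A) {xs ys : List A} → length xs ≡ length ys →
         (∀ {i} → i < length xs → at d xs i ≡ at d ys i) → xs ≡ ys
at-ext d {[]}     {[]}     _  _ = refl
at-ext d {x ∷ xs} {y ∷ ys} eq h =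
  cong₂ _∷_ (h z<s) (at-ext d (suc-injective eq) (λ i<n → h (s<s i<n)))

length-range : ∀ n → length (range n) ≡ n
length-range zero    = refl
length-range (suc n) =
  trans (length-++ (range n)) (trans (+-comm (length (range n)) 1) (cong suc (length-range n)))

length-prefixR : (f : ℕ → A) (n : ℕ) → length (prefixR f n) ≡ n
length-prefixR f n = trans (length-map f (range n)) (length-range n)

length-suffixL : (f : ℕ → A) (n : ℕ) → length (suffixL f n) ≡ n
length-suffixL f n = trans (length-reverse (prefixR f n)) (length-prefixR f n)

at-prefixR : (d : A) (f : ℕ → A) {n i : ℕ} → i < n → at d (prefixR f n) i ≡ f i
at-prefixR d f {suc n} {i} (s≤s i≤n) rewrite map-++ f (range n) (n ∷ [])
  with m≤n⇒m<n∨m≡n i≤n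
... | inj₁ i<n  =
  trans (at-++ˡ d (prefixR f n) _ (<-≤-trans i<n (≤-reflexive (sym (length-prefixR f n)))))
        (at-prefixR d f i<n)
... | inj₂ refl = at-++ʳ d (prefixR f n) _ (trans (+-identityʳ _) (length-prefixR f n))

at-prefixR-++ˡ : (d : A) (f : ℕ → A) (ys : List A) {n t : ℕ} → t < n →
                 at d (prefixR f n ++ ys) t ≡ f t
at-prefixR-++ˡ d f ys {n} t<n =
  trans (at-++ˡ d (prefixR f n) ys (<-≤-trans t<n (≤-reflexive (sym (length-prefixR f n)))))
        (at-prefixR d f t<n)

at-prefixR-++ʳ : (d : A) (f : ℕ → A) (ys : List A) (n j : ℕ) →
                 at d (prefixR f n ++ ys) (n + j) ≡ at d ys j
at-prefixR-++ʳ d f ys n j = at-++ʳ d (prefixR f n) ys (cong (_+ j) (length-prefixR f n))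

length-prefixR-++-suffixL : (f g : ℕ → A) (m n : ℕ) → length (prefixR f m ++ suffixL g n) ≡ m + n
length-prefixR-++-suffixL f g m n =
  trans (length-++ (prefixR f m)) (cong₂ _+_ (length-prefixR f m) (length-suffixL g n))

at-cons-prefixR : (f : ℕ → A) (n : ℕ) {q : ℕ} →
                  q < suc (length (prefixR (λ j → f (suc j)) n)) →
                  at (f 0) (f 0 ∷ prefixR (λ j → f (suc j)) n) q ≡ f q
at-cons-prefixR f n {zero}  _           = refl
at-cons-prefixR f n {suc q} (s≤s q<|xs|) =
  at-prefixR (f 0) (λ j → f (suc j)) (subst (q <_) (length-prefixR _ n) q<|xs|)

at-suffixL : (d : A) (f : ℕ → A) {n i k : ℕ} → i + suc k ≡ n → at d (suffixL f n) i ≡ f k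
at-suffixL d f {n} {i} {k} eq =
  trans (at-reverse d (prefixR f n) (trans eq (sym (length-prefixR f n))))
        (at-prefixR d f (≤-trans (m≤n+m (suc k) i) (≤-reflexive eq)))

rightWord-init : (w : List A) (a : A) (as : List A) {b i : ℕ} → length w ≡ b → i < b →
                 rightWord w (a ∷ as) i ≡ at a w i
rightWord-init w a as refl = if-<ᵇ-yes

rightWord-tail : (w : List A) (a : A) (as : List A) {b : ℕ} → length w ≡ b → ∀ j →
                 rightWord w (a ∷ as) (b + j) ≡ at a (a ∷ as) (j % suc (length as))
rightWord-tail w a as {b} refl j = trans (if-<ᵇ-no (m≤m+n b j))
  (cong (λ t → at a (a ∷ as) (t % suc (length as))) (m+n∸m≡n b j))

leftWord-init : (a : A) (as w : List A) {b i : ℕ} → length w ≡ b → i < b →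
                leftWord (a ∷ as) w i ≡ at a (reverse w) i
leftWord-init a as w refl = if-<ᵇ-yes

leftWord-tail : (a : A) (as w : List A) {b : ℕ} → length w ≡ b → ∀ j →
                leftWord (a ∷ as) w (b + j) ≡ at a (reverse (a ∷ as)) (j % suc (length as))
leftWord-tail a as w {b} refl j = trans (if-<ᵇ-no (m≤m+n b j))
  (cong (λ t → at a (reverse (a ∷ as)) (t % suc (length as))) (m+n∸m≡n b j))

≗-split : {f g : ℕ → A} (b : ℕ) → (∀ {i} → i < b → f i ≡ g i) →
          (∀ j → f (b + j) ≡ g (b + j)) → f ≗ g
≗-split {f = f} {g} b below above i with i <? b
... | yes i<b = below i<b
... | no  i≮b = subst (λ t → f t ≡ g t) (m+[n∸m]≡n (≮⇒≥ i≮b)) (above (i ∸ b))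

iterate-period : (f : ℕ → A) {a c b d : ℕ} →
                 (∀ t → a ≤ t → t + c < b → f (t + d) ≡ f t) →
                 ∀ q t → a ≤ t → t + q * d + c < b → f (t + q * d) ≡ f t
iterate-period f step zero t a≤t _ = cong f (+-identityʳ t)
iterate-period f {a} {c} {b} {d} step (suc q) t a≤t bound = begin
  f (t + (d + q * d)) ≡⟨ cong f (sym (+-assoc t d (q * d))) ⟩
  f (t + d + q * d)   ≡⟨ iterate-period f step q (t + d) (≤-trans a≤t (m≤m+n t d)) bound′ ⟩
  f (t + d)           ≡⟨ step t a≤t (≤-<-trans (+-monoˡ-≤ c (m≤m+n t (d + q * d))) bound) ⟩
  f t                 ∎
  where
  bound′ : t + d + q * d + c < b
  bound′ = subst (λ x → x + c < b) (sym (+-assoc t d (q * d))) bound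

periodic-mod : (f : ℕ → A) (b p : ℕ) .{{_ : NonZero p}} →
               (∀ s → b ≤ s → f (s + p) ≡ f s) → ∀ j → f (b + j) ≡ f (b + j % p)
periodic-mod f b p periodic j = begin
  f (b + j)                   ≡⟨ cong (λ t → f (b + t)) (m≡m%n+[m/n]*n j p) ⟩
  f (b + (j % p + j / p * p)) ≡⟨ cong f (sym (+-assoc b (j % p) (j / p * p))) ⟩
  f (b + j % p + j / p * p)   ≡⟨ iterate-period f {c = 0} (λ t b≤t _ → periodic t b≤t)
                                                 (j / p) (b + j % p) (m≤m+n b (j % p)) (n<1+n _) ⟩
  f (b + j % p)               ∎

periodic⇒rightWord : (r : ℕ → A) (a : A) (as : List A) (β : ℕ) →
                     (∀ {q} → q < suc (length as) → r (β + q) ≡ at a (a ∷ as) q) →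
                     (∀ s → β ≤ s → r (s + suc (length as)) ≡ r s) →
                     r ≗ rightWord (prefixR r β) (a ∷ as)
periodic⇒rightWord {A = A} r a as β block periodic = ≗-split β init tail
  where
  p : ℕ
  p = suc (length as)
  w : List A
  w = prefixR r β
  init : ∀ {i} → i < β → r i ≡ rightWord w (a ∷ as) i
  init i<β = sym (trans (rightWord-init w a as (length-prefixR r β) i<β) (at-prefixR a r i<β))
  tail : ∀ j → r (β + j) ≡ rightWord w (a ∷ as) (β + j)
  tail j = begin
    r (β + j)                    ≡⟨ periodic-mod r β p periodic j ⟩
    r (β + j % p)                ≡⟨ block (m%n<n j p) ⟩
    at a (a ∷ as) (j % p)        ≡⟨ rightWord-tail w a as (length-prefixR r β) j ⟨
    rightWord w (a ∷ as) (β + j) ∎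

periodic⇒leftWord : (l : ℕ → A) (a : A) (as : List A) (α : ℕ) →
                    (∀ {j q} → j + suc q ≡ suc (length as) → l (α + j) ≡ at a (a ∷ as) q) →
                    (∀ k → α ≤ k → l (k + suc (length as)) ≡ l k) →
                    l ≗ leftWord (a ∷ as) (suffixL l α)
periodic⇒leftWord {A = A} l a as α block periodic = ≗-split α init tail
  where
  p : ℕ
  p = suc (length as)
  w : List A
  w = suffixL l α
  init : ∀ {i} → i < α → l i ≡ leftWord (a ∷ as) w i
  init {i} i<α = sym (begin
    leftWord (a ∷ as) w i ≡⟨ leftWord-init a as w (length-suffixL l α) i<α ⟩
    at a (reverse w) i    ≡⟨ cong (λ xs → at a xs i) (reverse-involutive (prefixR l α)) ⟩
    at a (prefixR l α) i  ≡⟨ at-prefixR a l i<α ⟩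
    l i                   ∎)
  tail : ∀ j → l (α + j) ≡ leftWord (a ∷ as) w (α + j)
  tail j with m≤n⇒∃[o]m+o≡n (m%n<n j p)
  ... | q , 1+j%p+q≡p = begin
    l (α + j)                       ≡⟨ periodic-mod l α p periodic j ⟩
    l (α + j % p)                   ≡⟨ block j%p+1+q≡p ⟩
    at a (a ∷ as) q                 ≡⟨ at-reverse a (a ∷ as) j%p+1+q≡p ⟨
    at a (reverse (a ∷ as)) (j % p) ≡⟨ leftWord-tail a as w (length-suffixL l α) j ⟨
    leftWord (a ∷ as) w (α + j)     ∎
    where
    j%p+1+q≡p : j % p + suc q ≡ p
    j%p+1+q≡p = trans (+-suc (j % p) q) 1+j%p+q≡p

-- Rog and antidiagonals

AntidiagonalMatch : (ℕ → A) → (ℕ → A) → ℕ → ℕ → Set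
AntidiagonalMatch l r m N = ∀ k s → m ≤ k → m ≤ s → suc (k + s) ≡ N → l k ≡ r s

-- x = ρₘ and x′ = λₘ in the definition of rog(λₙ, ρₙ)
CanonicalWitness : (ℕ → A) → (ℕ → A) → ℕ → ℕ → Set
CanonicalWitness l r n m = prefixR r m ++ suffixL l n ≡ prefixR r n ++ suffixL l m

canonical-witness : (l r : ℕ → A) (n : ℕ) {m : ℕ} → CanonicalWitness l r n m →
                    RogWitness (suffixL l n) (prefixR r n) m
canonical-witness l r n {m} eq =
  prefixR r m , suffixL l m , length-prefixR r m , length-suffixL l m , eq

antidiagonal-mono : {l r : ℕ → A} {m m′ N : ℕ} → m ≤ m′ →
                    AntidiagonalMatch l r m N → AntidiagonalMatch l r m′ N
antidiagonal-mono m≤m′ match k s m′≤k m′≤s =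
  match k s (≤-trans m≤m′ m′≤k) (≤-trans m≤m′ m′≤s)

antidiagonal-flip : {l r : ℕ → A} {m N : ℕ} → AntidiagonalMatch l r m N →
                    AntidiagonalMatch r l m N
antidiagonal-flip match k s m≤k m≤s diag =
  sym (match s k m≤s m≤k (trans (cong suc (+-comm s k)) diag))

witness⇒antidiagonal : {l r : ℕ → A} {n m : ℕ} → RogWitness (suffixL l n) (prefixR r n) m →
                       AntidiagonalMatch l r m (n + m)
witness⇒antidiagonal {l = l} {r} {n} {m} (x , x′ , |x|≡m , _ , x++λₙ≡ρₙ++x′)
                     k s m≤k m≤s diag with m≤n⇒∃[o]m+o≡n m≤s
... | i , refl = begin
  l k                                  ≡⟨ at-suffixL (l 0) l i+1+k≡n ⟨
  at (l 0) (suffixL l n) i             ≡⟨ at-++ʳ (l 0) x (suffixL l n) (cong (_+ i) |x|≡m) ⟨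
  at (l 0) (x ++ suffixL l n) (m + i)  ≡⟨ cong (λ xs → at (l 0) xs (m + i)) x++λₙ≡ρₙ++x′ ⟩
  at (l 0) (prefixR r n ++ x′) (m + i) ≡⟨ at-prefixR-++ˡ (l 0) r x′ m+i<n ⟩
  r (m + i)                            ∎
  where
  i+1+k≡n : i + suc k ≡ n
  i+1+k≡n = +-cancelʳ-≡ m _ _ (begin
    i + suc k + m     ≡⟨ solve (List ℕ ∋ i ∷ k ∷ m ∷ []) ⟩
    suc (k + (m + i)) ≡⟨ diag ⟩
    n + m             ∎)
  m+i<n : m + i < n
  m+i<n = ≤-trans (+-monoˡ-≤ i (s≤s m≤k)) (≤-reflexive (trans (+-comm (suc k) i) i+1+k≡n))

antidiagonal⇒letter : {l r : ℕ → A} {n m i k : ℕ} → AntidiagonalMatch l r m (n + m) →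
                      i + suc k ≡ n → at (l 0) (prefixR r n ++ suffixL l m) (m + i) ≡ l k
antidiagonal⇒letter {A = A} {l} {r} {n} {m} {i} {k} match i+1+k≡n with m + i <? n
... | yes m+i<n = trans (at-prefixR-++ˡ (l 0) r _ m+i<n) (sym (match k (m + i) m≤k (m≤m+n m i) diag))
  where
  m≤k : m ≤ k
  m≤k = ≤-pred (+-cancelʳ-≤ i (suc m) (suc k)
                 (≤-trans m+i<n (≤-reflexive (trans (sym i+1+k≡n) (+-comm i (suc k))))))
  diag : suc (k + (m + i)) ≡ n + m
  diag = begin
    suc (k + (m + i)) ≡⟨ solve (List ℕ ∋ k ∷ m ∷ i ∷ []) ⟩
    i + suc k + m     ≡⟨ cong (_+ m) i+1+k≡n ⟩
    n + m             ∎
... | no  m+i≮n with m≤n⇒∃[o]m+o≡n (≮⇒≥ m+i≮n)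
...   | j , n+j≡m+i = begin
  at (l 0) ρₙλₘ (m + i)    ≡⟨ cong (at (l 0) ρₙλₘ) n+j≡m+i ⟨
  at (l 0) ρₙλₘ (n + j)    ≡⟨ at-prefixR-++ʳ (l 0) r _ n j ⟩
  at (l 0) (suffixL l m) j ≡⟨ at-suffixL (l 0) l j+1+k≡m ⟩
  l k                      ∎
  where
  ρₙλₘ : List A
  ρₙλₘ = prefixR r n ++ suffixL l m
  j+1+k≡m : j + suc k ≡ m
  j+1+k≡m = +-cancelʳ-≡ i _ _ (begin
    j + suc k + i   ≡⟨ solve (List ℕ ∋ j ∷ k ∷ i ∷ []) ⟩
    j + (i + suc k) ≡⟨ cong (j +_) i+1+k≡n ⟩
    j + n           ≡⟨ +-comm j n ⟩
    n + j           ≡⟨ n+j≡m+i ⟩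
    m + i           ∎)

antidiagonal⇒canonical : (l r : ℕ → A) (n : ℕ) {m : ℕ} → m ≤ n →
                         AntidiagonalMatch l r m (n + m) → CanonicalWitness l r n m
antidiagonal⇒canonical l r n {m} m≤n match = at-ext (l 0) same-length same-letter
  where
  |ρₘλₙ|≡m+n : length (prefixR r m ++ suffixL l n) ≡ m + n
  |ρₘλₙ|≡m+n = length-prefixR-++-suffixL r l m n
  same-length : length (prefixR r m ++ suffixL l n) ≡ length (prefixR r n ++ suffixL l m)
  same-length = trans |ρₘλₙ|≡m+n (trans (+-comm m n) (sym (length-prefixR-++-suffixL r l n m)))
  same-letter : ∀ {t} → t < length (prefixR r m ++ suffixL l n) →
                at (l 0) (prefixR r m ++ suffixL l n) t ≡ at (l 0) (prefixR r n ++ suffixL l m) t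
  same-letter {t} t<|ρₘλₙ| with t <? m
  ... | yes t<m =
    trans (at-prefixR-++ˡ (l 0) r _ t<m) (sym (at-prefixR-++ˡ (l 0) r _ (<-≤-trans t<m m≤n)))
  ... | no  t≮m with m≤n⇒∃[o]m+o≡n (≮⇒≥ t≮m)
  ...   | i , refl
    with m≤n⇒∃[o]m+o≡n (+-cancelˡ-< m i n (subst (m + i <_) |ρₘλₙ|≡m+n t<|ρₘλₙ|))
  ...     | k , 1+i+k≡n = begin
    at (l 0) (prefixR r m ++ suffixL l n) (m + i) ≡⟨ at-prefixR-++ʳ (l 0) r _ m i ⟩
    at (l 0) (suffixL l n) i                      ≡⟨ at-suffixL (l 0) l i+1+k≡n ⟩
    l k                                           ≡⟨ antidiagonal⇒letter match i+1+k≡n ⟨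
    at (l 0) (prefixR r n ++ suffixL l m) (m + i) ∎
    where
    i+1+k≡n : i + suc k ≡ n
    i+1+k≡n = trans (+-suc i k) 1+i+k≡n

rog-exists : DecidableEquality A → (l r : ℕ → A) (n : ℕ) →
             ∃[ m ] IsRog (suffixL l n) (prefixR r n) m
rog-exists _≟ᴬ_ l r n with least {P = CanonicalWitness l r n} (λ m → ≡-dec _≟ᴬ_ _ _) refl
... | m , m≤n , canonical , below-m = m , canonical-witness l r n canonical , minimal
  where
  minimal : ∀ j → RogWitness (suffixL l n) (prefixR r n) j → m ≤ j
  minimal j witness = ≮⇒≥ λ j<m → below-m j<m
    (antidiagonal⇒canonical l r n (<⇒≤ (<-≤-trans j<m m≤n)) (witness⇒antidiagonal witness))

rog≤ : {l r : ℕ → A} (n : ℕ) {m₀ m : ℕ} → IsRog (suffixL l n) (prefixR r n) m₀ →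
       AntidiagonalMatch l r m (n + m) → m₀ ≤ m
rog≤ {l = l} {r} n {m = m} (_ , minimal) match with m ≤? n
... | yes m≤n = minimal m (canonical-witness l r n (antidiagonal⇒canonical l r n m≤n match))
... | no  m≰n = ≤-trans (minimal n (canonical-witness l r n refl)) (<⇒≤ (≰⇒> m≰n))

-- Bounded rog forces ultimate periodicity

antidiagonal-shift : {l r : ℕ → A} {m N d : ℕ} →
                     AntidiagonalMatch l r m N → AntidiagonalMatch l r m (N + d) →
                     ∀ s → m ≤ s → s + m < N → r (s + d) ≡ r s
antidiagonal-shift {m = m} {N} {d} match match′ s m≤s s+m<N with m≤n⇒∃[o]m+o≡n s+m<N
... | c , 1+s+m+c≡N =
  trans (sym (match′ (m + c) (s + d) (m≤m+n m c) (≤-trans m≤s (m≤m+n s d)) diag′))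
        (match (m + c) s (m≤m+n m c) m≤s diag)
  where
  diag : suc (m + c + s) ≡ N
  diag = begin
    suc (m + c + s) ≡⟨ solve (List ℕ ∋ m ∷ c ∷ s ∷ []) ⟩
    suc (s + m) + c ≡⟨ 1+s+m+c≡N ⟩
    N               ∎
  diag′ : suc (m + c + (s + d)) ≡ N + d
  diag′ = trans (cong suc (sym (+-assoc (m + c) s d))) (cong (_+ d) diag)

SyndeticMatching : (ℕ → A) → (ℕ → A) → ℕ → Set
SyndeticMatching l r M = ∀ n → ∃[ m ] m ≤ M × AntidiagonalMatch l r M (n + m)

finite-rog⇒syndetic : DecidableEquality A → {l r : ℕ → A} → FiniteSet (InROG l r) →
                      ∃[ M ] SyndeticMatching l r M
finite-rog⇒syndetic _≟ᴬ_ {l} {r} (L , complete) = max 0 L , matching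
  where
  matching : SyndeticMatching l r (max 0 L)
  matching n with rog-exists _≟ᴬ_ l r n
  ... | m , isRog = m , m≤max , antidiagonal-mono m≤max (witness⇒antidiagonal (proj₁ isRog))
    where
    m≤max : m ≤ max 0 L
    m≤max = All.lookup (xs≤max 0 L) (complete m (n , isRog))

module _ {l r : ℕ → A} {M : ℕ} (matching : SyndeticMatching l r M) where

  close-antidiagonals : ∀ n → ∃₂ λ N d → n ≤ N × 0 < d × d ≤ suc (M + M) ×
                        AntidiagonalMatch l r M N × AntidiagonalMatch l r M (N + d)
  close-antidiagonals n with matching n | matching (n + suc M)
  ... | m₁ , m₁≤M , match₁ | m₂ , m₂≤M , match₂ =
    n + m₁ , suc M ∸ m₁ + m₂ , m≤m+n n m₁ ,
    ≤-trans (m<n⇒0<n∸m (s≤s m₁≤M)) (m≤m+n (suc M ∸ m₁) m₂) ,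
    +-mono-≤ (m∸n≤m (suc M) m₁) m₂≤M ,
    match₁ , subst (AntidiagonalMatch l r M) regroup match₂
    where
    m₁≤1+M : m₁ ≤ suc M
    m₁≤1+M = m≤n⇒m≤1+n m₁≤M
    regroup : n + suc M + m₂ ≡ n + m₁ + (suc M ∸ m₁ + m₂)
    regroup = begin
      n + suc M + m₂               ≡⟨ cong (λ t → n + t + m₂) (m+[n∸m]≡n m₁≤1+M) ⟨
      n + (m₁ + (suc M ∸ m₁)) + m₂ ≡⟨ cong (_+ m₂) (+-assoc n m₁ (suc M ∸ m₁)) ⟨
      n + m₁ + (suc M ∸ m₁) + m₂   ≡⟨ +-assoc (n + m₁) (suc M ∸ m₁) m₂ ⟩
      n + m₁ + (suc M ∸ m₁ + m₂)   ∎

  -- a common multiple of all the local periods d ≤ 2M + 1 provided by close-antidiagonals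
  period : ℕ
  period = suc (M + M) !

  eventually-periodic : ∀ s → M ≤ s → r (s + period) ≡ r s × l (s + period) ≡ l s
  eventually-periodic s M≤s with close-antidiagonals (suc (s + period + M))
  ... | N , d , n≤N , 0<d , d≤1+2M , match , match′ with 0<m≤n⇒m∣n! 0<d d≤1+2M
  ...   | divides q period≡q*d =
    by-multiple r (iterate-period r (antidiagonal-shift match match′) q s M≤s in-window) ,
    by-multiple l (iterate-period l l-shift q s M≤s in-window)
    where
    l-shift : ∀ t → M ≤ t → t + M < N → l (t + d) ≡ l t
    l-shift = antidiagonal-shift (antidiagonal-flip match) (antidiagonal-flip match′)
    in-window : s + q * d + M < N
    in-window = ≤-trans (≤-reflexive (cong (λ p → suc (s + p + M)) (sym period≡q*d))) n≤N
    by-multiple : (f : ℕ → A) → f (s + q * d) ≡ f s → f (s + period) ≡ f s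
    by-multiple f = subst (λ p → f (s + p) ≡ f s) (sym period≡q*d)

  syndetic⇒ultimately-periodic :
    Σ (List⁺ A) λ u → Σ (List A) λ w₁ → Σ (List A) λ w₂ →
      (l ≗ leftWord u w₁) × (r ≗ rightWord w₂ u)
  syndetic⇒ultimately-periodic with matching (M + M + period)
  ... | m , _ , match =
    r (M + 0) ∷ u-tail , suffixL l (M + m) , prefixR r M ,
    periodic⇒leftWord l (r (M + 0)) u-tail (M + m) link
      (λ k M+m≤k → by-length l (proj₂ (eventually-periodic k (≤-trans (m≤m+n M m) M+m≤k)))) ,
    periodic⇒rightWord r (r (M + 0)) u-tail M block
      (λ s M≤s → by-length r (proj₁ (eventually-periodic s M≤s)))
    where
    u-tail : List A
    u-tail = prefixR (λ j → r (M + suc j)) (pred period)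
    |u|≡period : suc (length u-tail) ≡ period
    |u|≡period =
      trans (cong suc (length-prefixR _ (pred period))) (suc-pred period {{suc (M + M) !≢0}})
    by-length : (f : ℕ → A) {s : ℕ} → f (s + period) ≡ f s → f (s + suc (length u-tail)) ≡ f s
    by-length f {s} = subst (λ p → f (s + p) ≡ f s) (sym |u|≡period)
    block : ∀ {q} → q < suc (length u-tail) → r (M + q) ≡ at (r (M + 0)) (r (M + 0) ∷ u-tail) q
    block q<|u| = sym (at-cons-prefixR (λ j → r (M + j)) (pred period) q<|u|)
    link : ∀ {j q} → j + suc q ≡ suc (length u-tail) →
           l (M + m + j) ≡ at (r (M + 0)) (r (M + 0) ∷ u-tail) q
    link {j} {q} j+1+q≡|u| =
      trans (match (M + m + j) (M + q) (≤-trans (m≤m+n M m) (m≤m+n (M + m) j)) (m≤m+n M q) diag)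
            (block (≤-trans (m≤n+m (suc q) j) (≤-reflexive j+1+q≡|u|)))
      where
      diag : suc (M + m + j + (M + q)) ≡ M + M + period + m
      diag = begin
        suc (M + m + j + (M + q)) ≡⟨ solve (List ℕ ∋ M ∷ m ∷ j ∷ q ∷ []) ⟩
        M + M + (j + suc q) + m   ≡⟨ cong (λ p → M + M + p + m) (trans j+1+q≡|u| |u|≡period) ⟩
        M + M + period + m        ∎

-- Ultimately periodic words have bounded rog

antidiagonal-from-offsets : {l r : ℕ → A} {p α β n e : ℕ} → p ∣ n + e →
                            (∀ {x y} → p ∣ x + suc y → l (α + x) ≡ r (β + y)) →
                            AntidiagonalMatch l r (α + β + e) (n + (α + β + e))
antidiagonal-from-offsets {p = p} {α} {β} {n} {e} p∣n+e offsets-match k s α+β+e≤k α+β+e≤s diag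
  with m≤n⇒∃[o]m+o≡n (≤-trans (≤-trans (m≤m+n α β) (m≤m+n (α + β) e)) α+β+e≤k)
     | m≤n⇒∃[o]m+o≡n (≤-trans (≤-trans (m≤n+m β α) (m≤m+n (α + β) e)) α+β+e≤s)
... | x , refl | y , refl = offsets-match (subst (p ∣_) (sym x+1+y≡n+e) p∣n+e)
  where
  x+1+y≡n+e : x + suc y ≡ n + e
  x+1+y≡n+e = +-cancelˡ-≡ (α + β) _ _ (begin
    α + β + (x + suc y)   ≡⟨ solve (List ℕ ∋ α ∷ β ∷ x ∷ y ∷ []) ⟩
    suc (α + x + (β + y)) ≡⟨ diag ⟩
    n + (α + β + e)       ≡⟨ solve (List ℕ ∋ n ∷ α ∷ β ∷ e ∷ []) ⟩
    α + β + (n + e)       ∎)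

module _ {l r : ℕ → A} (a : A) (as w₁ w₂ : List A)
         (l≗ : l ≗ leftWord (a ∷ as) w₁) (r≗ : r ≗ rightWord w₂ (a ∷ as)) where

  private
    p α β : ℕ
    p = suc (length as)
    α = length w₁
    β = length w₂

  tails-match : ∀ {x y} → p ∣ x + suc y → l (α + x) ≡ r (β + y)
  tails-match {x} {y} p∣x+1+y = begin
    l (α + x)                       ≡⟨ trans (l≗ (α + x)) (leftWord-tail a as w₁ refl x) ⟩
    at a (reverse (a ∷ as)) (x % p) ≡⟨ at-reverse a (a ∷ as) (%-complement p p∣x+1+y) ⟩
    at a (a ∷ as) (y % p)           ≡⟨ trans (r≗ (β + y)) (rightWord-tail w₂ a as refl y) ⟨
    r (β + y)                       ∎

  ultimately-periodic⇒rog-bounded : ∀ n {m₀} → IsRog (suffixL l n) (prefixR r n) m₀ →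
                                    m₀ ≤ α + β + p
  ultimately-periodic⇒rog-bounded n isRog with next-multiple n p
  ... | e , e≤p , p∣n+e = ≤-trans (rog≤ n isRog match) (+-monoʳ-≤ (α + β) e≤p)
    where
    match : AntidiagonalMatch l r (α + β + e) (n + (α + β + e))
    match = antidiagonal-from-offsets {α = α} {β} {n} p∣n+e tails-match

  ultimately-periodic⇒finite-rog : FiniteSet (InROG l r)
  ultimately-periodic⇒finite-rog =
    upTo (suc (α + β + p)) ,
    λ m₀ (n , isRog) → ∈-upTo⁺ (s≤s (ultimately-periodic⇒rog-bounded n isRog))

theorem3p5 : (A : Set) (k : ℕ) → A ↔ Fin (suc k) →
    (l : ℕ → A) (r : ℕ → A) →
    FiniteSet (InROG l r) ⇔
      Σ (List⁺ A) (λ u → Σ (List A) (λ w₁ → Σ (List A) (λ w₂ →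
        ((i : ℕ) → l i ≡ leftWord u w₁ i) × ((i : ℕ) → r i ≡ rightWord w₂ u i))))
theorem3p5 A k A↔Fin l r = mk⇔
  (λ finite → syndetic⇒ultimately-periodic (proj₂ (finite-rog⇒syndetic _≟ᴬ_ finite)))
  λ { (a ∷ as , w₁ , w₂ , l≗ , r≗) → ultimately-periodic⇒finite-rog a as w₁ w₂ l≗ r≗ }
  where
  _≟ᴬ_ : DecidableEquality A
  _≟ᴬ_ = via-injection (↔⇒↣ A↔Fin) Fin._≟_
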